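{- For every integer $r \ge 0$ and $k \ge 1$, the matching width of the graph $CT_{r,k}$ is at least $rk/2$.
   Context: $T_r$ is the complete binary tree of height $r$ ($2^{r+1}-1$ nodes). $CT_{r,k}$ is obtained from $T_r$ by replacing each node by a clique on $k$ vertices (vertex-disjoint cliques) and, for each edge $\{a,b\}$ of $T_r$, making all vertices of the clique of $a$ adjacent to all vertices of the clique of $b$. Matching width: for a permutation $SV$ of $V(G)$ and a prefix $S_1$ of $SV$, the matching width of $S_1$ is the maximum size of a matching (set of pairwise vertex-disjoint edges) consisting of edges with one end in $S_1$ and the other in $V(G)\setminus S_1$; the matching width of $SV$ is the maximum matching width over its prefixes; the matching width $mw(G)$ of $G$ is the minimum matching width over all permutations of $V(G)$. -}

module Defs where

open import Level using (0ℓ)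
open import Data.Nat using (ℕ; zero; suc; _+_; _*_; _∸_; _^_; _≤_; _<_)
open import Data.Fin using (Fin; toℕ)
open import Data.Product using (Σ; _×_; _,_; proj₁; proj₂; ∃-syntax)
open import Data.Sum using (_⊎_)
open import Data.List using (List; length; concatMap; _∷_; [])
open import Data.List.Relation.Unary.All using (All)
open import Data.List.Relation.Unary.Unique.Propositional using (Unique)
open import Relation.Binary.PropositionalEquality using (_≡_; _≢_)
open import Function.Bundles using (_↔_; Inverse)

record Graph : Set₁ where
  field
    V   : Set
    Adj : V → V → Set

open Graph public

-- A linear ordering SV of V(G): a bijection between Fin n and V(G)
-- (so n = |V(G)|).  Position of v in the ordering is  toℕ (from v).
Ordering : Graph → ℕ → Set
Ordering G n = Fin n ↔ V G

InPrefix : (G : Graph) {n : ℕ} → Ordering G n → ℕ → V G → Set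
InPrefix G σ t v = toℕ (Inverse.from σ v) < t

endpoints : {A : Set} → List (A × A) → List A
endpoints = concatMap (λ e → proj₁ e ∷ proj₂ e ∷ [])

IsCrossMatching : (G : Graph) {n : ℕ} → Ordering G n → ℕ → List (V G × V G) → Set
IsCrossMatching G σ t M =
  All (λ e → Adj G (proj₁ e) (proj₂ e)
             × InPrefix G σ t (proj₁ e)
             × (InPrefix G σ t (proj₂ e) → Data.Empty.⊥)) M
  × Unique (endpoints M)
  where import Data.Empty

PrefixMW≥ : (G : Graph) {n : ℕ} → Ordering G n → ℕ → ℕ → Set
PrefixMW≥ G σ t m = Σ (List (V G × V G)) λ M → IsCrossMatching G σ t M × m ≤ length M

OrderingMW≥ : (G : Graph) {n : ℕ} → Ordering G n → ℕ → Set
OrderingMW≥ G {n} σ m = Σ ℕ λ t → t ≤ n × PrefixMW≥ G σ t m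

MW≥ : Graph → ℕ → Set
MW≥ G m = (n : ℕ) (σ : Ordering G n) → OrderingMW≥ G σ m

-- T_r with heap indexing: nodes 0 .. 2^(r+1) - 2, node a has children 2a+1, 2a+2.
numNodes : ℕ → ℕ
numNodes r = 2 ^ (suc r) ∸ 1

Child : {N : ℕ} → Fin N → Fin N → Set
Child a b = (toℕ b ≡ 2 * toℕ a + 1) ⊎ (toℕ b ≡ 2 * toℕ a + 2)

TreeEdge : {N : ℕ} → Fin N → Fin N → Set
TreeEdge a b = Child a b ⊎ Child b a

-- CT_{r,k}: vertex (a , i) is the i-th vertex of the clique of node a.
CT : ℕ → ℕ → Graph
CT r k = record
  { V   = Fin (numNodes r) × Fin k
  ; Adj = λ x y → ((proj₁ x ≡ proj₁ y) × (proj₂ x ≢ proj₂ y))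
                  ⊎ TreeEdge (proj₁ x) (proj₁ y)
  }

-- A certificate for the subtree at p fixes a prefix length t
-- and provides a crossing matching inside the subtree together with k vertices of the subtree
-- inside the prefix and k outside it. The cliques of a node and its left child hold 2k vertices;
-- since the prefix grows one vertex at a time, some prefix contains exactly k of them, which
-- starts the induction with a matching of size k. Two levels up, order the certificates of three
-- grandchildren by t and use the middle time: the prefix vertices of the earliest one are still in
-- the prefix, the outside vertices of the latest one are still outside, and the subtree minus the
-- middle grandchild's subtree is connected. There k new crossing edges, disjoint from the middle
-- matching, are found greedily: walk from a free prefix vertex towards a free outside vertex,
-- taking a free vertex in every node passed (fewer than k of its k vertices are used), and stop
-- at the first one outside the prefix. So every two levels of height add k edges.

module Submission where

open import Defs
open import Data.Bool using (Bool; true; false)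
open import Data.Empty using (⊥-elim)
open import Data.Fin using (Fin; toℕ; fromℕ<)
open import Data.Fin.Properties using (toℕ-fromℕ<; toℕ-injective; toℕ<n)
import Data.Fin.Properties as Fin
open import Data.List using (List; []; _∷_; _++_; length; filter; tabulate)
open import Data.List.Properties
  using (++-assoc; length-++; length-tabulate; concatMap-++; filter-none; filter-all; ∷-injectiveˡ; ∷-injectiveʳ)
open import Data.List.Membership.Propositional using (_∈_; _∉_; find)
open import Data.List.Membership.Propositional.Properties using (∈-filter⁺)
open import Data.List.Relation.Unary.All as All using (All; []; _∷_)
open import Data.List.Relation.Unary.All.Properties
  using (¬All⇒Any¬; ¬Any⇒All¬; all-filter; filter⁺; ++⁺; tabulate⁺)
open import Data.List.Relation.Unary.Any using (here; there; any?)
open import Data.List.Relation.Unary.Unique.Propositional using (Unique; []; _∷_)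
import Data.List.Relation.Unary.Unique.Propositional.Properties as Unique
open import Data.Nat using (ℕ; zero; suc; _+_; _*_; _^_; _≤_; _<_; _≤?_; _<?_; z≤n; s≤s; z<s; ⌈_/2⌉)
open import Data.Nat.Properties
open import Data.Nat.Tactic.RingSolver using (solve-∀)
open import Data.Product using (_×_; _,_; proj₁; proj₂; ∃; ∃-syntax; map₁; map₂)
open import Data.Product.Properties using (≡-dec)
open import Data.Sum using (inj₁; inj₂; swap)
open import Data.Unit using (⊤; tt)
open import Function using (_∘_; id; Inverse)
open import Relation.Binary.Construct.Closure.Transitive as TransClosure using (TransClosure; [_]; _∷_)
open import Relation.Binary.Definitions using (DecidableEquality; Symmetric)
open import Relation.Binary.PropositionalEquality
  using (_≡_; _≢_; refl; sym; trans; cong; cong₂; subst; module ≡-Reasoning)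
open import Relation.Nullary using (¬_; yes; no)
open import Relation.Nullary.Decidable using (decidable-stable)
open import Relation.Unary using (Decidable)
open import Relation.Unary.Properties using (∁?)

module _ {A : Set} where

  private
    remove : {x : A} {ys : List A} → x ∈ ys → List A
    remove {ys = _ ∷ ys} (here _)  = ys
    remove {ys = y ∷ _}  (there p) = y ∷ remove p

    length-remove : {x : A} {ys : List A} (p : x ∈ ys) → length ys ≡ suc (length (remove p))
    length-remove (here _)  = refl
    length-remove (there p) = cong suc (length-remove p)

    ∈-remove : {x y : A} {ys : List A} (p : x ∈ ys) → y ∈ ys → y ≢ x → y ∈ remove p
    ∈-remove (here refl) (here y≡x)  y≢x = ⊥-elim (y≢x y≡x)
    ∈-remove (here refl) (there y∈)  _   = y∈
    ∈-remove (there p)   (here y≡)   _   = here y≡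
    ∈-remove (there p)   (there y∈)  y≢x = there (∈-remove p y∈ y≢x)

  unique-⊆⇒length≤ : {xs ys : List A} → Unique xs → All (_∈ ys) xs → length xs ≤ length ys
  unique-⊆⇒length≤ {[]}     _              _             = z≤n
  unique-⊆⇒length≤ {x ∷ xs} {ys} (x∉xs ∷ u) (x∈ys ∷ xs⊆ys) =
    subst (suc (length xs) ≤_) (sym (length-remove x∈ys))
      (s≤s (unique-⊆⇒length≤ u (All.zipWith (λ (x≢y , y∈ys) → ∈-remove x∈ys y∈ys (x≢y ∘ sym)) (x∉xs , xs⊆ys))))

  unique-longer⇒∃∉ : DecidableEquality A → {xs ys : List A} → Unique xs → length ys < length xs →
                     ∃[ x ] x ∈ xs × x ∉ ys
  unique-longer⇒∃∉ _≟_ {xs} {ys} u ys<xs with All.all? (λ x → any? (x ≟_) ys) xs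
  ... | yes xs⊆ys = ⊥-elim (<⇒≱ ys<xs (unique-⊆⇒length≤ u xs⊆ys))
  ... | no  xs⊈ys = find (¬All⇒Any¬ (λ x → any? (x ≟_) ys) xs xs⊈ys)

  length-filter+length-filter-∁ : {P : A → Set} (P? : Decidable P) (xs : List A) →
                                  length (filter P? xs) + length (filter (∁? P?) xs) ≡ length xs
  length-filter+length-filter-∁ P? []       = refl
  length-filter+length-filter-∁ P? (x ∷ xs) with P? x
  ... | yes _ = cong suc (length-filter+length-filter-∁ P? xs)
  ... | no  _ = trans (+-suc _ _) (cong suc (length-filter+length-filter-∁ P? xs))

  length-filter-endpoints≤ : {P : A → Set} (P? : Decidable P) (M : List (A × A)) →
                             All (λ e → ¬ (P (proj₁ e) × P (proj₂ e))) M →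
                             length (filter P? (endpoints M)) ≤ length M
  length-filter-endpoints≤ P? [] [] = z≤n
  length-filter-endpoints≤ P? ((a , b) ∷ M) (¬ab ∷ rest) with P? a
  ... | yes pa with P? b
  ...   | yes pb = ⊥-elim (¬ab (pa , pb))
  ...   | no _   = s≤s (length-filter-endpoints≤ P? M rest)
  length-filter-endpoints≤ P? ((a , b) ∷ M) (¬ab ∷ rest) | no _ with P? b
  ...   | yes _ = s≤s (length-filter-endpoints≤ P? M rest)
  ...   | no _  = m≤n⇒m≤1+n (length-filter-endpoints≤ P? M rest)

  length-filter-mono : {P Q : A → Set} (P? : Decidable P) (Q? : Decidable Q) {xs : List A} →
                       All (λ x → Q x → P x) xs → length (filter Q? xs) ≤ length (filter P? xs)
  length-filter-mono P? Q? {[]}     []           = z≤n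
  length-filter-mono P? Q? {x ∷ xs} (Q⇒P ∷ rest) with P? x | Q? x
  ... | yes _  | yes _  = s≤s (length-filter-mono P? Q? rest)
  ... | yes _  | no _   = m≤n⇒m≤1+n (length-filter-mono P? Q? rest)
  ... | no ¬px | yes qx = ⊥-elim (¬px (Q⇒P qx))
  ... | no _   | no _   = length-filter-mono P? Q? rest

  length-filter-≤-suc : {P Q : A → Set} (P? : Decidable P) (Q? : Decidable Q) →
                        (∀ {x} → P x → Q x) → (∀ {x y} → Q x → ¬ P x → Q y → ¬ P y → x ≡ y) →
                        {xs : List A} → Unique xs → length (filter Q? xs) ≤ suc (length (filter P? xs))
  length-filter-≤-suc P? Q? P⇒Q extra≡ {[]}     []         = z≤n
  length-filter-≤-suc P? Q? P⇒Q extra≡ {x ∷ xs} (x∉xs ∷ u) with P? x | Q? x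
  ... | yes _  | yes _  = s≤s (length-filter-≤-suc P? Q? P⇒Q extra≡ u)
  ... | yes px | no ¬qx = ⊥-elim (¬qx (P⇒Q px))
  ... | no ¬px | yes qx = s≤s (length-filter-mono P? Q?
                            (All.map (λ x≢y qy → decidable-stable (P? _) (λ ¬py → x≢y (extra≡ qx ¬px qy ¬py))) x∉xs))
  ... | no _   | no _   = length-filter-≤-suc P? Q? P⇒Q extra≡ u

discrete-ivt : (f : ℕ → ℕ) → f 0 ≡ 0 → (∀ t → f (suc t) ≤ suc (f t)) →
               ∀ {m} n → m ≤ f n → ∃[ t ] t ≤ n × f t ≡ m
discrete-ivt f f0≡0 step zero m≤f0 = 0 , z≤n , trans f0≡0 (sym (n≤0⇒n≡0 (subst (_ ≤_) f0≡0 m≤f0)))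
discrete-ivt f f0≡0 step {m} (suc n) m≤fn+1 with m ≤? f n
... | yes m≤fn = let t , t≤n , ft≡m = discrete-ivt f f0≡0 step n m≤fn in t , m≤n⇒m≤1+n t≤n , ft≡m
... | no  m≰fn = suc n , ≤-refl , ≤-antisym (≤-trans (step n) (≰⇒> m≰fn)) m≤fn+1

-- A node is named by its path read upwards to the root: false for a left child, true for a right one.
heapIndex : List Bool → ℕ
heapIndex []          = 0
heapIndex (false ∷ p) = 2 * heapIndex p + 1
heapIndex (true  ∷ p) = 2 * heapIndex p + 2

m<2*m+suc[n] : ∀ x c → x < 2 * x + suc c
m<2*m+suc[n] x c = ≤-<-trans (m≤n*m x 2) (m<m+n (2 * x) z<s)

heapIndex-parent< : ∀ b p → heapIndex p < heapIndex (b ∷ p)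
heapIndex-parent< false p = m<2*m+suc[n] (heapIndex p) 0
heapIndex-parent< true  p = m<2*m+suc[n] (heapIndex p) 1

heapIndex-injective : ∀ p q → heapIndex p ≡ heapIndex q → p ≡ q
heapIndex-injective []          []          _  = refl
heapIndex-injective []          (false ∷ q) eq = ⊥-elim (0≢1+n (trans eq (+-comm _ 1)))
heapIndex-injective []          (true  ∷ q) eq = ⊥-elim (0≢1+n (trans eq (+-comm _ 2)))
heapIndex-injective (false ∷ p) []          eq = ⊥-elim (0≢1+n (trans (sym eq) (+-comm _ 1)))
heapIndex-injective (true  ∷ p) []          eq = ⊥-elim (0≢1+n (trans (sym eq) (+-comm _ 2)))
heapIndex-injective (false ∷ p) (false ∷ q) eq =
  cong (false ∷_) (heapIndex-injective p q (*-cancelˡ-≡ _ _ 2 (+-cancelʳ-≡ 1 _ _ eq)))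
heapIndex-injective (true  ∷ p) (true  ∷ q) eq =
  cong (true ∷_) (heapIndex-injective p q (*-cancelˡ-≡ _ _ 2 (+-cancelʳ-≡ 2 _ _ eq)))
heapIndex-injective (false ∷ p) (true  ∷ q) eq =
  ⊥-elim (even≢odd (heapIndex p) (heapIndex q) (suc-injective (trans (+-comm 1 _) (trans eq (+-comm _ 2)))))
heapIndex-injective (true  ∷ p) (false ∷ q) eq =
  ⊥-elim (even≢odd (heapIndex q) (heapIndex p) (suc-injective (trans (+-comm 1 _) (trans (sym eq) (+-comm _ 2)))))

heapIndex+2≤2^[1+length] : ∀ p → heapIndex p + 2 ≤ 2 ^ suc (length p)
heapIndex+2≤2^[1+length] []          = ≤-refl
heapIndex+2≤2^[1+length] (false ∷ p) =
  ≤-trans (n≤1+n _) (≤-trans (≤-reflexive (slack (heapIndex p))) (*-monoʳ-≤ 2 (heapIndex+2≤2^[1+length] p)))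
  where
  slack : ∀ x → suc (2 * x + 1 + 2) ≡ 2 * (x + 2)
  slack = solve-∀
heapIndex+2≤2^[1+length] (true  ∷ p) =
  ≤-trans (≤-reflexive (exact (heapIndex p))) (*-monoʳ-≤ 2 (heapIndex+2≤2^[1+length] p))
  where
  exact : ∀ x → 2 * x + 2 + 2 ≡ 2 * (x + 2)
  exact = solve-∀

heapIndex<numNodes : ∀ {r} p → length p ≤ r → heapIndex p < numNodes r
heapIndex<numNodes {r} p p≤r = m+n≤o⇒m≤o∸n (suc (heapIndex p))
  (subst (_≤ 2 ^ suc r) (+-suc (heapIndex p) 1) (≤-trans (heapIndex+2≤2^[1+length] p) (^-monoʳ-≤ 2 (s≤s p≤r))))

Descendant : List Bool → ℕ → Set
Descendant p i = ∃[ q ] i ≡ heapIndex (q ++ p)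

Descendant-++ : ∀ g p {i} → Descendant (g ++ p) i → Descendant p i
Descendant-++ g p (q , i≡) = q ++ g , trans i≡ (cong heapIndex (sym (++-assoc q g p)))

Descendant-child : ∀ b g u → Descendant g (heapIndex u) → Descendant g (heapIndex (b ∷ u))
Descendant-child b g u (q , i≡) = b ∷ q , cong (heapIndex ∘ (b ∷_)) (heapIndex-injective u (q ++ g) i≡)

Descendant-disjoint : ∀ g g' {i} → length g ≡ length g' → g ≢ g' → Descendant g i → ¬ Descendant g' i
Descendant-disjoint g g' |g|≡|g'| g≢g' (q , i≡) (q' , i≡') = g≢g' (suffix≡ q q' |q|≡|q'| q++g≡q'++g')
  where
  q++g≡q'++g' : q ++ g ≡ q' ++ g'
  q++g≡q'++g' = heapIndex-injective _ _ (trans (sym i≡) i≡')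
  |q|≡|q'| : length q ≡ length q'
  |q|≡|q'| = +-cancelʳ-≡ (length g) _ _ (begin
    length q + length g    ≡⟨ length-++ q ⟨
    length (q ++ g)        ≡⟨ cong length q++g≡q'++g' ⟩
    length (q' ++ g')      ≡⟨ length-++ q' ⟩
    length q' + length g'  ≡⟨ cong (length q' +_) |g|≡|g'| ⟨
    length q' + length g   ∎)
    where open ≡-Reasoning
  suffix≡ : ∀ xs ys → length xs ≡ length ys → xs ++ g ≡ ys ++ g' → g ≡ g'
  suffix≡ []       []       _ eq = eq
  suffix≡ (_ ∷ xs) (_ ∷ ys) l eq = suffix≡ xs ys (suc-injective l) (∷-injectiveʳ eq)

¬Descendant-grandchild : ∀ b b' p → ¬ Descendant (b ∷ b' ∷ p) (heapIndex (false ∷ p))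
¬Descendant-grandchild b b' p (q , i≡) = m≢1+n+m (suc (length p)) (begin
  length (false ∷ p)               ≡⟨ cong length (heapIndex-injective (false ∷ p) (q ++ b ∷ b' ∷ p) i≡) ⟩
  length (q ++ b ∷ b' ∷ p)         ≡⟨ length-++ q ⟩
  length q + suc (suc (length p))  ≡⟨ +-suc (length q) _ ⟩
  suc (length q + suc (length p))  ∎)
  where open ≡-Reasoning

Child-irreflexive : ∀ {M} {a : Fin M} → ¬ Child a a
Child-irreflexive {a = a} (inj₁ a≡) = <⇒≢ (m<2*m+suc[n] (toℕ a) 0) a≡
Child-irreflexive {a = a} (inj₂ a≡) = <⇒≢ (m<2*m+suc[n] (toℕ a) 1) a≡

TreeEdge-irreflexive : ∀ {M} {a b : Fin M} → TreeEdge a b → a ≢ b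
TreeEdge-irreflexive (inj₁ c) refl = Child-irreflexive c
TreeEdge-irreflexive (inj₂ c) refl = Child-irreflexive c

childEdge : ∀ {M} b u {a c : Fin M} → toℕ a ≡ heapIndex u → toℕ c ≡ heapIndex (b ∷ u) → Child a c
childEdge false u a≡ c≡ = inj₁ (trans c≡ (cong (λ i → 2 * i + 1) (sym a≡)))
childEdge true  u a≡ c≡ = inj₂ (trans c≡ (cong (λ i → 2 * i + 2) (sym a≡)))

grandchild : Bool × Bool → List Bool → List Bool
grandchild (b , b') p = b ∷ b' ∷ p

grandchild-injective : ∀ q q' p → grandchild q p ≡ grandchild q' p → q ≡ q'
grandchild-injective _ _ _ eq = cong₂ _,_ (∷-injectiveˡ eq) (∷-injectiveˡ (∷-injectiveʳ eq))

⌈m*k/2⌉≤⌈m/2⌉*k : ∀ m k → ⌈ m * k /2⌉ ≤ ⌈ m /2⌉ * k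
⌈m*k/2⌉≤⌈m/2⌉*k m k = begin
  ⌈ m * k /2⌉          ≤⟨ ⌈n/2⌉-mono (*-monoˡ-≤ k m≤c+c) ⟩
  ⌈ (c + c) * k /2⌉    ≡⟨ cong ⌈_/2⌉ (*-distribʳ-+ k c c) ⟩
  ⌈ c * k + c * k /2⌉  ≡⟨ n≡⌈n+n/2⌉ (c * k) ⟨
  c * k                ∎
  where
  open ≤-Reasoning
  c : ℕ
  c = ⌈ m /2⌉
  m≤c+c : m ≤ c + c
  m≤c+c = subst (_≤ c + c) (⌊n/2⌋+⌈n/2⌉≡n m) (+-monoˡ-≤ c (⌊n/2⌋≤⌈n/2⌉ m))

module LowerBound (r k n : ℕ) (σ : Ordering (CT r k) n) where

  N : ℕ
  N = numNodes r

  Vertex : Set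
  Vertex = Fin N × Fin k

  node : Vertex → Fin N
  node = proj₁

  _≟ᵥ_ : DecidableEquality Vertex
  _≟ᵥ_ = ≡-dec Fin._≟_ Fin._≟_

  position : Vertex → ℕ
  position v = toℕ (Inverse.from σ v)

  position-injective : ∀ {v w} → position v ≡ position w → v ≡ w
  position-injective {v} {w} eq = begin
    v                                ≡⟨ Inverse.strictlyInverseˡ σ v ⟨
    Inverse.to σ (Inverse.from σ v)  ≡⟨ cong (Inverse.to σ) (toℕ-injective eq) ⟩
    Inverse.to σ (Inverse.from σ w)  ≡⟨ Inverse.strictlyInverseˡ σ w ⟩
    w                                ∎
    where open ≡-Reasoning

  In : ℕ → Vertex → Set
  In = InPrefix (CT r k) σ

  In? : ∀ t → Decidable (In t)
  In? t v = position v <? t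

  Out : ℕ → Vertex → Set
  Out t v = ¬ In t v

  Below : List Bool → Fin N → Set
  Below p a = Descendant p (toℕ a)

  record Pool (S : Vertex → Set) : Set where
    field
      members  : List Vertex
      distinct : Unique members
      enough   : k ≤ length members
      sound    : All S members

  Pool-map : ∀ {S S'} → (∀ {v} → S v → S' v) → Pool S → Pool S'
  Pool-map f A = record
    { members = members ; distinct = distinct ; enough = enough ; sound = All.map f sound }
    where open Pool A

  Pool-filter : ∀ {S R} (S? : Decidable S) {xs} → Unique xs → All R xs → k ≤ length (filter S? xs) →
                Pool (λ v → S v × R v)
  Pool-filter S? {xs} u all-R k≤ = record
    { members = filter S? xs ; distinct = Unique.filter⁺ S? u ; enough = k≤
    ; sound = All.zip (all-filter S? xs , filter⁺ S? all-R) }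

  clique : ∀ c → Pool (λ v → node v ≡ c)
  clique c = record
    { members = tabulate (c ,_) ; distinct = Unique.tabulate⁺ (λ { refl → refl })
    ; enough = ≤-reflexive (sym (length-tabulate (c ,_))) ; sound = tabulate⁺ (λ _ → refl) }

  Link : (Fin N → Set) → Fin N → Fin N → Set
  Link P a b = TreeEdge a b × P a × P b

  Link-sym : ∀ {P} → Symmetric (Link P)
  Link-sym (e , Pa , Pb) = swap e , Pb , Pa

  module Linking (t : ℕ) (P : Fin N → Set) where

    record Linkage (M : List (Vertex × Vertex)) : Set where
      field
        edges    : All (λ e → TreeEdge (node (proj₁ e)) (node (proj₂ e)) × In t (proj₁ e) × Out t (proj₂ e)) M
        distinct : Unique (endpoints M)
        inside   : All (P ∘ node) (endpoints M)

    isCrossMatching : ∀ {M} → Linkage M → IsCrossMatching (CT r k) σ t M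
    isCrossMatching L = All.map (λ (e , x-in , y-out) → inj₂ e , x-in , y-out) (Linkage.edges L) , Linkage.distinct L

    Addable : List (Vertex × Vertex) → Vertex × Vertex → Set
    Addable M (x , y) = Link P (node x) (node y) × In t x × Out t y × x ∉ endpoints M × y ∉ endpoints M

    extend : ∀ {M e} → Linkage M → Addable M e → Linkage (e ∷ M)
    extend {e = x , y} L ((e , Px , Py) , x-in , y-out , x∉ , y∉) = record
      { edges    = (e , x-in , y-out) ∷ Linkage.edges L
      ; distinct = (x≢y ∷ ¬Any⇒All¬ _ x∉) ∷ ¬Any⇒All¬ _ y∉ ∷ Linkage.distinct L
      ; inside   = Px ∷ Py ∷ Linkage.inside L }
      where
      x≢y : x ≢ y
      x≢y refl = y-out x-in

    module _ {M} (L : Linkage M) (short : length M < k) where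

      -- Each edge of M has at most one endpoint in S, so fewer than k endpoints lie in S.
      fresh : ∀ {S R} (S? : Decidable S) → All (λ e → ¬ (S (proj₁ e) × S (proj₂ e))) M →
              Pool R → (∀ {v} → R v → S v) → ∃[ x ] R x × x ∉ endpoints M
      fresh {R = R} S? one-sided A R⇒S
        with unique-longer⇒∃∉ _≟ᵥ_ (Pool.distinct A)
               (≤-<-trans (length-filter-endpoints≤ S? M one-sided) (<-≤-trans short (Pool.enough A)))
      ... | x , x∈A , x∉ = x , Rx , λ x∈E → x∉ (∈-filter⁺ S? x∈E (R⇒S Rx))
        where
        Rx : R x
        Rx = All.lookup (Pool.sound A) x∈A

      freeOn : ∀ c → ∃[ i ] (c , i) ∉ endpoints M
      freeOn c with fresh (λ v → node v Fin.≟ c)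
                     (All.map (λ (e , _) (a≡c , b≡c) → TreeEdge-irreflexive e (trans a≡c (sym b≡c))) (Linkage.edges L))
                     (clique c) id
      ... | (_ , i) , refl , i∉ = i , i∉

      freshIn : Pool (λ v → In t v × P (node v)) → ∃[ x ] (In t x × P (node x)) × x ∉ endpoints M
      freshIn A = fresh (In? t) (All.map (λ (_ , _ , y-out) (_ , y-in) → y-out y-in) (Linkage.edges L)) A proj₁

      freshOut : Pool (λ v → Out t v × P (node v)) → ∃[ y ] (Out t y × P (node y)) × y ∉ endpoints M
      freshOut B = fresh (∁? (In? t)) (All.map (λ (_ , x-in , _) (x-out , _) → x-out x-in) (Linkage.edges L)) B proj₁

      route : ∀ x y → In t x → x ∉ endpoints M → Out t y → y ∉ endpoints M →
              TransClosure (Link P) (node x) (node y) → ∃ (Addable M)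
      route x y x-in x∉ y-out y∉ [ link ] = (x , y) , link , x-in , y-out , x∉ , y∉
      route x y x-in x∉ y-out y∉ (_∷_ {y = c} (e , Px , Pc) walk) with freeOn c
      ... | i , i∉ with In? t (c , i)
      ...   | yes i-in  = route (c , i) y i-in i∉ y-out y∉ walk
      ...   | no  i-out = (x , (c , i)) , (e , Px , Pc) , x-in , i-out , x∉ , i∉

    link : (∀ {a b} → P a → P b → TransClosure (Link P) a b) →
           Pool (λ v → In t v × P (node v)) → Pool (λ v → Out t v × P (node v)) →
           ∃[ M ] length M ≡ k × Linkage M
    link connected A B = grow k ≤-refl
      where
      augment : ∀ {M} → Linkage M → length M < k → ∃ (Addable M)
      augment L short =
        let x , (x-in , Px) , x∉ = freshIn L short A
            y , (y-out , Py) , y∉ = freshOut L short B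
        in route L short x y x-in x∉ y-out y∉ (connected Px Py)

      grow : ∀ s → s ≤ k → ∃[ M ] length M ≡ s × Linkage M
      grow zero    _   = [] , refl , record { edges = [] ; distinct = [] ; inside = [] }
      grow (suc s) s<k with grow s (<⇒≤ s<k)
      ... | M , refl , L = let e , addable = augment L s<k in e ∷ M , refl , extend L addable

  module Region (p : List Bool) (p<r : length p < r) (Q : ℕ → Set)
                (Q-parent : ∀ b u → Q (heapIndex (b ∷ u)) → Q (heapIndex u))
                (Q-leftChild : Q (heapIndex (false ∷ p))) where

    Inside : Fin N → Set
    Inside a = Below p a × Q (toℕ a)

    root : Fin N
    root = fromℕ< (heapIndex<numNodes p (<⇒≤ p<r))

    leftChild : Fin N
    leftChild = fromℕ< (heapIndex<numNodes (false ∷ p) p<r)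

    root-index : toℕ root ≡ heapIndex p
    root-index = toℕ-fromℕ< _

    leftChild-index : toℕ leftChild ≡ heapIndex (false ∷ p)
    leftChild-index = toℕ-fromℕ< _

    root-inside : Inside root
    root-inside = ([] , root-index) , subst Q (sym root-index) (Q-parent false p Q-leftChild)

    leftChild-inside : Inside leftChild
    leftChild-inside = (false ∷ [] , leftChild-index) , subst Q (sym leftChild-index) Q-leftChild

    -- At the root itself the walk detours through the left child, so that it is never empty.
    toRoot : ∀ q {a} → toℕ a ≡ heapIndex (q ++ p) → Q (toℕ a) → TransClosure (Link Inside) a root
    toRoot [] a≡ Qa =
      (inj₁ (childEdge false p a≡ leftChild-index) , (([] , a≡) , Qa) , leftChild-inside) ∷
      [ inj₂ (childEdge false p root-index leftChild-index) , leftChild-inside , root-inside ]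
    toRoot (b ∷ q) {a} a≡ Qa =
      (inj₂ (childEdge b (q ++ p) u≡ a≡) , ((b ∷ q , a≡) , Qa) , ((q , u≡) , Qu)) ∷ toRoot q u≡ Qu
      where
      u<N : heapIndex (q ++ p) < N
      u<N = <-trans (heapIndex-parent< b (q ++ p)) (subst (_< N) a≡ (toℕ<n a))
      u≡ : toℕ (fromℕ< u<N) ≡ heapIndex (q ++ p)
      u≡ = toℕ-fromℕ< u<N
      Qu : Q (toℕ (fromℕ< u<N))
      Qu = subst Q (sym u≡) (Q-parent b (q ++ p) (subst Q a≡ Qa))

    connected : ∀ {a b} → Inside a → Inside b → TransClosure (Link Inside) a b
    connected ((qa , a≡) , Qa) ((qb , b≡) , Qb) =
      toRoot qa a≡ Qa TransClosure.++ TransClosure.symmetric _ Link-sym (toRoot qb b≡ Qb)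

  record Certificate (p : List Bool) (m : ℕ) : Set where
    field
      time     : ℕ
      time≤n   : time ≤ n
      matching : List (Vertex × Vertex)
      crossing : IsCrossMatching (CT r k) σ time matching
      large    : m ≤ length matching
      inside   : All (Below p ∘ node) (endpoints matching)
      left     : Pool (λ v → In time v × Below p (node v))
      right    : Pool (λ v → Out time v × Below p (node v))

  open Certificate public

  weaken : ∀ {p m m'} → m' ≤ m → Certificate p m → Certificate p m'
  weaken m'≤m C = record
    { time = time C ; time≤n = time≤n C ; matching = matching C ; crossing = crossing C
    ; large = ≤-trans m'≤m (large C) ; inside = inside C ; left = left C ; right = right C }

  base : ∀ p → length p < r → Certificate p k
  base p p<r = record
    { time = t ; time≤n = t≤n ; matching = proj₁ linked ; crossing = isCrossMatching L
    ; large = ≤-reflexive (sym (proj₁ (proj₂ linked))) ; inside = All.map proj₁ (Linkage.inside L)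
    ; left = Pool-map (map₂ proj₁) A ; right = Pool-map (map₂ proj₁) B }
    where
    open Region p p<r (λ _ → ⊤) (λ _ _ _ → tt) tt

    vertices : List Vertex
    vertices = Pool.members (clique root) ++ Pool.members (clique leftChild)

    root≢leftChild : root ≢ leftChild
    root≢leftChild eq =
      <⇒≢ (heapIndex-parent< false p) (trans (sym root-index) (trans (cong toℕ eq) leftChild-index))

    vertices-unique : Unique vertices
    vertices-unique = Unique.++⁺ (Pool.distinct (clique root)) (Pool.distinct (clique leftChild))
      λ (v∈root , v∈leftChild) → root≢leftChild
        (trans (sym (All.lookup (Pool.sound (clique root)) v∈root)) (All.lookup (Pool.sound (clique leftChild)) v∈leftChild))

    vertices-inside : All (Inside ∘ node) vertices
    vertices-inside = ++⁺ (All.map (λ { refl → root-inside }) (Pool.sound (clique root)))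
                          (All.map (λ { refl → leftChild-inside }) (Pool.sound (clique leftChild)))

    |vertices| : length vertices ≡ k + k
    |vertices| = trans (length-++ (Pool.members (clique root)))
                       (cong₂ _+_ (length-tabulate {n = k} (root ,_)) (length-tabulate {n = k} (leftChild ,_)))

    count : ℕ → ℕ
    count t = length (filter (In? t) vertices)

    halfway : ∃[ t ] t ≤ n × count t ≡ k
    halfway = discrete-ivt count
      (cong length (filter-none (In? 0) (All.universal (λ _ ()) vertices)))
      (λ t → length-filter-≤-suc (In? t) (In? (suc t)) m≤n⇒m≤1+n
               (λ x<t+1 x≮t y<t+1 y≮t → position-injective (trans (at x<t+1 x≮t) (sym (at y<t+1 y≮t))))
               vertices-unique)
      n (subst (k ≤_) (sym (trans (cong length (filter-all (In? n) (All.universal (λ _ → toℕ<n _) vertices))) |vertices|))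
                     (m≤m+n k k))
      where
      at : ∀ {v t} → position v < suc t → ¬ position v < t → position v ≡ t
      at v<t+1 v≮t = ≤-antisym (≤-pred v<t+1) (≮⇒≥ v≮t)

    t : ℕ
    t = proj₁ halfway

    t≤n : t ≤ n
    t≤n = proj₁ (proj₂ halfway)

    A : Pool (λ v → In t v × Inside (node v))
    A = Pool-filter (In? t) vertices-unique vertices-inside (≤-reflexive (sym (proj₂ (proj₂ halfway))))

    B : Pool (λ v → Out t v × Inside (node v))
    B = Pool-filter (∁? (In? t)) vertices-unique vertices-inside (≤-reflexive (sym (+-cancelˡ-≡ k _ _ (begin
      k + outside        ≡⟨ cong (_+ outside) (proj₂ (proj₂ halfway)) ⟨
      count t + outside  ≡⟨ length-filter+length-filter-∁ (In? t) vertices ⟩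
      length vertices    ≡⟨ |vertices| ⟩
      k + k              ∎))))
      where
      open ≡-Reasoning
      outside : ℕ
      outside = length (filter (∁? (In? t)) vertices)

    open Linking t Inside

    linked : ∃[ M ] length M ≡ k × Linkage M
    linked = link connected A B

    L : Linkage (proj₁ linked)
    L = proj₂ (proj₂ linked)

  Below-grandchild : ∀ q p {a} → Below (grandchild q p) a → Below p a
  Below-grandchild (b , b') p = Descendant-++ (b ∷ b' ∷ []) p

  combine : ∀ {p m} (lo mid hi : Bool × Bool) → length p < r → lo ≢ mid → hi ≢ mid →
            (X : Certificate (grandchild lo p) m) (Y : Certificate (grandchild mid p) m)
            (Z : Certificate (grandchild hi p) m) → time X ≤ time Y → time Y ≤ time Z →
            Certificate p (k + m)
  combine {p} {m} lo mid hi p<r lo≢mid hi≢mid X Y Z X≤Y Y≤Z = record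
    { time     = time Y
    ; time≤n   = time≤n Y
    ; matching = M ++ matching Y
    ; crossing = ++⁺ (proj₁ (isCrossMatching L)) (proj₁ (crossing Y)) ,
                 subst Unique (sym endpoints-++) (Unique.++⁺ (Linkage.distinct L) (proj₂ (crossing Y))
                   λ (v∈M , v∈Y) → proj₂ (All.lookup (Linkage.inside L) v∈M) (All.lookup (inside Y) v∈Y))
    ; large    = subst (k + m ≤_) (sym (length-++ M)) (+-mono-≤ (≤-reflexive (sym (proj₁ (proj₂ linked)))) (large Y))
    ; inside   = subst (All (Below p ∘ node)) (sym endpoints-++)
                   (++⁺ (All.map proj₁ (Linkage.inside L)) (All.map (Below-grandchild mid p) (inside Y)))
    ; left     = Pool-map (map₂ (Below-grandchild lo p)) early
    ; right    = Pool-map (map₂ (Below-grandchild hi p)) late }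
    where
    open Region p p<r (¬_ ∘ Descendant (grandchild mid p)) (λ b u → _∘ Descendant-child b (grandchild mid p) u)
                (¬Descendant-grandchild (proj₁ mid) (proj₂ mid) p)

    outside-mid : ∀ {q} → q ≢ mid → ∀ {a} → Below (grandchild q p) a → Inside a
    outside-mid {q} q≢mid below =
      Below-grandchild q p below , Descendant-disjoint _ _ refl (q≢mid ∘ grandchild-injective q mid p) below

    early : Pool (λ v → In (time Y) v × Below (grandchild lo p) (node v))
    early = Pool-map (map₁ (λ v-in → <-≤-trans v-in X≤Y)) (left X)

    late : Pool (λ v → Out (time Y) v × Below (grandchild hi p) (node v))
    late = Pool-map (map₁ (λ v-out v-in → v-out (<-≤-trans v-in Y≤Z))) (right Z)

    open Linking (time Y) Inside

    linked : ∃[ M ] length M ≡ k × Linkage M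
    linked = link connected (Pool-map (map₂ (outside-mid lo≢mid)) early) (Pool-map (map₂ (outside-mid hi≢mid)) late)

    M : List (Vertex × Vertex)
    M = proj₁ linked

    L : Linkage M
    L = proj₂ (proj₂ linked)

    endpoints-++ : endpoints (M ++ matching Y) ≡ endpoints M ++ endpoints (matching Y)
    endpoints-++ = concatMap-++ _ M (matching Y)

  combine₃ : ∀ {p m} → length p < r → Certificate (grandchild (false , false) p) m →
             Certificate (grandchild (true , false) p) m → Certificate (grandchild (false , true) p) m →
             Certificate p (k + m)
  combine₃ p<r X Y Z with ≤-total (time X) (time Y) | ≤-total (time Y) (time Z) | ≤-total (time X) (time Z)
  ... | inj₁ X≤Y | inj₁ Y≤Z | _        = combine _ _ _ p<r (λ ()) (λ ()) X Y Z X≤Y Y≤Z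
  ... | inj₁ X≤Y | inj₂ Z≤Y | inj₁ X≤Z = combine _ _ _ p<r (λ ()) (λ ()) X Z Y X≤Z Z≤Y
  ... | inj₁ X≤Y | inj₂ Z≤Y | inj₂ Z≤X = combine _ _ _ p<r (λ ()) (λ ()) Z X Y Z≤X X≤Y
  ... | inj₂ Y≤X | inj₁ Y≤Z | inj₁ X≤Z = combine _ _ _ p<r (λ ()) (λ ()) Y X Z Y≤X X≤Z
  ... | inj₂ Y≤X | inj₁ Y≤Z | inj₂ Z≤X = combine _ _ _ p<r (λ ()) (λ ()) Y Z X Y≤Z Z≤X
  ... | inj₂ Y≤X | inj₂ Z≤Y | _        = combine _ _ _ p<r (λ ()) (λ ()) Z Y X Z≤Y Y≤X

  certificate : ∀ h p → length p + h < r → Certificate p (⌈ suc h /2⌉ * k)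
  certificate zero          p p+0<r =
    weaken (≤-reflexive (+-identityʳ k)) (base p (subst (_< r) (+-identityʳ _) p+0<r))
  -- ⌈ 2 /2⌉ = ⌈ 1 /2⌉, so height 2 is handled as height 1.
  certificate (suc zero)    p p+1<r = certificate zero p (≤-<-trans (+-monoʳ-≤ (length p) z≤n) p+1<r)
  certificate (suc (suc h)) p p+h+2<r =
    combine₃ (≤-<-trans (m≤m+n _ _) p+h+2<r)
      (certificate h (grandchild (false , false) p) g+h<r)
      (certificate h (grandchild (true  , false) p) g+h<r)
      (certificate h (grandchild (false , true ) p) g+h<r)
    where
    g+h<r : suc (suc (length p)) + h < r
    g+h<r = subst (_< r) (trans (+-suc _ _) (cong suc (+-suc _ _))) p+h+2<r

lemma2 : (r k : ℕ) → 1 ≤ k → MW≥ (CT r k) ⌈ r * k /2⌉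
lemma2 zero    k _ n σ = 0 , z≤n , [] , ([] , []) , z≤n
lemma2 (suc r) k _ n σ =
  time C , time≤n C , matching C , crossing C , ≤-trans (⌈m*k/2⌉≤⌈m/2⌉*k (suc r) k) (large C)
  where
  open LowerBound (suc r) k n σ
  C : Certificate [] (⌈ suc r /2⌉ * k)
  C = certificate r [] ≤-refl
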